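{- Let $\mathbf{A}_n$ be the Cartan matrix of type $A_n$ and let $\mathbf{B}$ be a square submatrix of $\mathbf{A}_n$ obtained by deleting some rows and the same number of columns. Then either $\det(\mathbf{B})=0$, or there exist an integer $0\le m\le n$ and a partition $\mu=(\mu_1,\dots,\mu_\ell)$ of $m$ with $\ell\le n+1-m$ parts such that $|\det(\mathbf{B})|=(\mu_1+1)(\mu_2+1)\cdots(\mu_\ell+1)$. In particular, $|\det(\mathbf{B})|$ divides $(n+1)!$.
   Context: The Cartan matrix $\mathbf{A}_n$ of type $A_n$ is the $n\times n$ matrix with entries $2$ on the diagonal, $-1$ in positions $(i,i+1)$ and $(i+1,i)$, and $0$ elsewhere. -}

module Defs where

open import Data.Nat as ℕ using (ℕ; zero; suc)
open import Data.Integer as ℤ using (ℤ; +_; -_; -1ℤ; 0ℤ; 1ℤ)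
open import Data.Fin as Fin using (Fin; toℕ; punchIn)
open import Data.List using (List; []; _∷_)
open import Data.Nat.ListAction using (sum)
open import Data.Bool using (if_then_else_)
open import Relation.Nullary.Decidable using (⌊_⌋)
open import Relation.Binary.PropositionalEquality using (_≡_)

Matrix : ℕ → Set
Matrix k = Fin k → Fin k → ℤ

cartanA : (n : ℕ) → Matrix n
cartanA n i j =
  if ⌊ toℕ i ℕ.≟ toℕ j ⌋ then + 2
  else if ⌊ suc (toℕ i) ℕ.≟ toℕ j ⌋ then -1ℤ
  else if ⌊ toℕ i ℕ.≟ suc (toℕ j) ⌋ then -1ℤ
  else 0ℤ

sign : ℕ → ℤ
sign zero = 1ℤ
sign (suc i) = - sign i

∑ : (k : ℕ) → (Fin k → ℤ) → ℤ
∑ zero f = 0ℤ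
∑ (suc k) f = f Fin.zero ℤ.+ ∑ k (λ i → f (Fin.suc i))

det : (k : ℕ) → Matrix k → ℤ
det zero M = 1ℤ
det (suc k) M =
  ∑ (suc k) (λ i → sign (toℕ i) ℤ.* (M i Fin.zero ℤ.*
     det k (λ r c → M (punchIn i r) (Fin.suc c))))

-- Strictly increasing maps Fin k → Fin n (i.e. a choice of k indices out of n).
StrictlyIncreasing : {k n : ℕ} → (Fin k → Fin n) → Set
StrictlyIncreasing {k} f = (i j : Fin k) → i Fin.< j → f i Fin.< f j

submatrix : {n k : ℕ} → Matrix n → (Fin k → Fin n) → (Fin k → Fin n) → Matrix k
submatrix M rs cs i j = M (rs i) (cs j)

data Decreasing : List ℕ → Set where
  []  : Decreasing []
  [_] : (x : ℕ) → Decreasing (x ∷ [])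
  _∷_ : {x y : ℕ} {xs : List ℕ} → y ℕ.≤ x → Decreasing (y ∷ xs) → Decreasing (x ∷ y ∷ xs)

data AllPositive : List ℕ → Set where
  []  : AllPositive []
  _∷_ : {x : ℕ} {xs : List ℕ} → 0 ℕ.< x → AllPositive xs → AllPositive (x ∷ xs)

record IsPartition (m : ℕ) (μ : List ℕ) : Set where
  field
    positive   : AllPositive μ
    decreasing : Decreasing μ
    sums       : sum μ ≡ m

{-# OPTIONS --safe #-}
module Submission where

-- Expand det B along its first column. If the first row and column indices differ by two or
-- more, the first row or column of B is zero; if they differ by one, it is (-1, 0, …, 0) and
-- det B is minus the determinant of the rest. If they agree, B begins with a maximal run of p
-- common consecutive indices, on which it is the Cartan block A_p; the recurrence
-- det A_{p+1} = 2 det A_p - det A_{p-1} shows that det A_p = p + 1 splits off as a factor.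
-- A run is followed by an index that is not common to rows and columns, so the runs μ₁, μ₂, …
-- satisfy ∑ (μᵢ + 1) ≤ n + 1. Sorting them gives the partition, and
-- ∏ (μᵢ + 1) ∣ ∏ (μᵢ + 1)! ∣ (∑ (μᵢ + 1))! ∣ (n + 1)!.

open import Defs
open import Data.Nat as ℕ using (ℕ; zero; suc; _≤_; _<_; _∸_; _+_; _⊔_; _!; z≤n; s≤s)
open import Data.Nat.Properties
  using (≤-refl; ≤-reflexive; ≤-trans; <⇒≤; <-trans; <-≤-trans; ≤-<-trans; <-asym; <-cmp; n<1+n;
         m<n⇒m<1+n; m≤n⇒m<n∨m≡n; 1+n≢n; <⇒≢; >⇒≢; +-suc; +-comm; +-assoc; +-identityʳ; +-monoʳ-≤;
         +-monoˡ-≤; m≤m+n; m+n≤o⇒n≤o; m+n≤o⇒m≤o∸n; m+n∸m≡n; ⊔-idem; ⊔-lub; ⊔-mono-≤; m≤n⇒m≤n⊔o;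
         m≤n⇒m≤o⊔n; ≤-decTotalOrder)
open import Data.Nat.Divisibility using (_∣_; ∣-refl; ∣-trans; *-pres-∣; m∣m*n; m≤n⇒m!∣n!)
open import Data.Nat.Combinatorics using (k![n∸k]!∣n!)
open import Data.Nat.ListAction using (sum; product)
open import Data.Nat.ListAction.Properties using (sum-↭; product-↭)
open import Data.Integer as ℤ using (ℤ; +_; -_; _*_; _-_; ∣_∣; 0ℤ; 1ℤ; -1ℤ)
import Data.Integer.Properties as ℤ
open import Data.Integer.Tactic.RingSolver using (solve-∀)
open import Data.Fin using (Fin; toℕ; punchIn)
open import Data.Fin.Properties using (toℕ<n)
open import Data.List using (List; []; _∷_; length; map)
open import Data.List.Relation.Unary.All using (All; []; _∷_)
open import Data.List.Relation.Unary.Linked using (Linked; []; [-]; _∷_)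
open import Data.List.Relation.Binary.Permutation.Propositional using (_↭_; ↭-sym)
open import Data.List.Relation.Binary.Permutation.Propositional.Properties using (All-resp-↭; map⁺)
import Relation.Binary.Construct.Flip.EqAndOrd as Flip
open import Data.List.Sort (Flip.decTotalOrder ≤-decTotalOrder) using (sort; sort-↭; sort-↗)
open import Data.Product using (_×_; _,_; ∃-syntax)
open import Data.Sum using (_⊎_; inj₁; inj₂; [_,_]′)
open import Function using (_∘_)
open import Relation.Nullary using (yes; no; contradiction)
open import Relation.Binary using (tri<; tri≈; tri>)
open import Relation.Binary.PropositionalEquality
  using (_≡_; _≢_; refl; sym; trans; cong; cong₂; subst; subst₂; module ≡-Reasoning)

open Fin using (zero; suc)

∑-zero : ∀ k {f : Fin k → ℤ} → (∀ i → f i ≡ 0ℤ) → ∑ k f ≡ 0ℤ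
∑-zero zero    f≡0 = refl
∑-zero (suc k) f≡0 = cong₂ ℤ._+_ (f≡0 zero) (∑-zero k (f≡0 ∘ suc))

minor : ∀ {k} → Matrix (suc k) → Fin (suc k) → Matrix k
minor M i r c = M (punchIn i r) (suc c)

expansionTerm : ∀ {k} → Matrix (suc k) → Fin (suc k) → ℤ
expansionTerm {k} M i = sign (toℕ i) * (M i zero * det k (minor M i))

expansionTerm-zeroEntry : ∀ {k} (M : Matrix (suc k)) i → M i zero ≡ 0ℤ → expansionTerm M i ≡ 0ℤ
expansionTerm-zeroEntry {k} M i Mi0≡0 =
  trans (cong (λ a → sign (toℕ i) * (a * det k (minor M i))) Mi0≡0) (ℤ.*-zeroʳ (sign (toℕ i)))

expansionTerm-zeroMinor : ∀ {k} (M : Matrix (suc k)) i → det k (minor M i) ≡ 0ℤ → expansionTerm M i ≡ 0ℤ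
expansionTerm-zeroMinor {k} M i det≡0 = begin
  sign (toℕ i) * (M i zero * det k (minor M i)) ≡⟨ cong (λ d → sign (toℕ i) * (M i zero * d)) det≡0 ⟩
  sign (toℕ i) * (M i zero * 0ℤ)                ≡⟨ cong (sign (toℕ i) *_) (ℤ.*-zeroʳ (M i zero)) ⟩
  sign (toℕ i) * 0ℤ                             ≡⟨ ℤ.*-zeroʳ (sign (toℕ i)) ⟩
  0ℤ                                            ∎
  where open ≡-Reasoning

det-zeroCol₀ : ∀ {k} (M : Matrix (suc k)) → (∀ i → M i zero ≡ 0ℤ) → det (suc k) M ≡ 0ℤ
det-zeroCol₀ {k} M col≡0 =
  ∑-zero (suc k) {expansionTerm M} (λ i → expansionTerm-zeroEntry M i (col≡0 i))

det-zeroRow₀ : ∀ {k} (M : Matrix (suc k)) → (∀ j → M zero j ≡ 0ℤ) → det (suc k) M ≡ 0ℤ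
det-zeroRow₀ {zero}  M row≡0 =
  ∑-zero 1 {expansionTerm M} λ { zero → expansionTerm-zeroEntry M zero (row≡0 zero) }
det-zeroRow₀ {suc k} M row≡0 = ∑-zero (suc (suc k)) {expansionTerm M} λ
  { zero    → expansionTerm-zeroEntry M zero (row≡0 zero)
  ; (suc i) → expansionTerm-zeroMinor M (suc i) (det-zeroRow₀ (minor M (suc i)) (row≡0 ∘ suc))
  }

det-headTerm : ∀ {k} (M : Matrix (suc k)) → (∀ i → expansionTerm M (suc i) ≡ 0ℤ) →
               det (suc k) M ≡ M zero zero * det k (minor M zero)
det-headTerm {k} M rest≡0 = begin
  1ℤ * x ℤ.+ ∑ k (λ i → expansionTerm M (suc i)) ≡⟨ cong (ℤ._+_ (1ℤ * x)) (∑-zero k rest≡0) ⟩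
  1ℤ * x ℤ.+ 0ℤ                                  ≡⟨ ℤ.+-identityʳ (1ℤ * x) ⟩
  1ℤ * x                                         ≡⟨ ℤ.*-identityˡ x ⟩
  x                                              ∎
  where
  open ≡-Reasoning
  x = M zero zero * det k (minor M zero)

det-col₀-oneTerm : ∀ {k} (M : Matrix (suc k)) → (∀ i → M (suc i) zero ≡ 0ℤ) →
                   det (suc k) M ≡ M zero zero * det k (minor M zero)
det-col₀-oneTerm M col≡0 = det-headTerm M (λ i → expansionTerm-zeroEntry M (suc i) (col≡0 i))

det-row₀-oneTerm : ∀ {k} (M : Matrix (suc k)) → (∀ j → M zero (suc j) ≡ 0ℤ) →
                   det (suc k) M ≡ M zero zero * det k (minor M zero)
det-row₀-oneTerm {zero}  M row≡0 = det-headTerm M (λ ())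
det-row₀-oneTerm {suc k} M row≡0 =
  det-headTerm M (λ i → expansionTerm-zeroMinor M (suc i) (det-zeroRow₀ (minor M (suc i)) row≡0))

det-col₀-twoTerms : ∀ {k} (M : Matrix (suc (suc k))) → (∀ i → M (suc (suc i)) zero ≡ 0ℤ) →
  det (suc (suc k)) M ≡ M zero zero * det (suc k) (minor M zero)
                        - M (suc zero) zero * det (suc k) (minor M (suc zero))
det-col₀-twoTerms {k} M col≡0 = begin
  1ℤ * x ℤ.+ (-1ℤ * y ℤ.+ ∑ k (λ i → expansionTerm M (suc (suc i))))
    ≡⟨ cong (λ s → 1ℤ * x ℤ.+ (-1ℤ * y ℤ.+ s))
            (∑-zero k {λ i → expansionTerm M (suc (suc i))}
                    (λ i → expansionTerm-zeroEntry M (suc (suc i)) (col≡0 i))) ⟩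
  1ℤ * x ℤ.+ (-1ℤ * y ℤ.+ 0ℤ)
    ≡⟨ cong₂ ℤ._+_ (ℤ.*-identityˡ x) (ℤ.+-identityʳ (-1ℤ * y)) ⟩
  x ℤ.+ -1ℤ * y
    ≡⟨ cong (ℤ._+_ x) (ℤ.-1*i≡-i y) ⟩
  x - y ∎
  where
  open ≡-Reasoning
  x = M zero zero * det (suc k) (minor M zero)
  y = M (suc zero) zero * det (suc k) (minor M (suc zero))

data BandPosition (a b : ℕ) : Set where
  diagonal      : a ≡ b     → BandPosition a b
  superdiagonal : suc a ≡ b → BandPosition a b
  subdiagonal   : a ≡ suc b → BandPosition a b
  aboveBand     : suc a < b → BandPosition a b
  belowBand     : suc b < a → BandPosition a b

bandPosition : ∀ a b → BandPosition a b
bandPosition a b with <-cmp a b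
... | tri≈ _ a≡b _ = diagonal a≡b
... | tri< a<b _ _ = [ aboveBand , superdiagonal ]′ (m≤n⇒m<n∨m≡n a<b)
... | tri> _ _ b<a = [ belowBand , subdiagonal ∘ sym ]′ (m≤n⇒m<n∨m≡n b<a)

module _ {n : ℕ} {i j : Fin n} where

  cartanA-diagonal : toℕ i ≡ toℕ j → cartanA n i j ≡ + 2
  cartanA-diagonal i≡j with toℕ i ℕ.≟ toℕ j
  ... | yes _   = refl
  ... | no  i≢j = contradiction i≡j i≢j

  cartanA-superdiagonal : suc (toℕ i) ≡ toℕ j → cartanA n i j ≡ -1ℤ
  cartanA-superdiagonal 1+i≡j with toℕ i ℕ.≟ toℕ j | suc (toℕ i) ℕ.≟ toℕ j
  ... | yes i≡j | _        = contradiction (trans 1+i≡j (sym i≡j)) 1+n≢n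
  ... | no _    | yes _    = refl
  ... | no _    | no 1+i≢j = contradiction 1+i≡j 1+i≢j

  cartanA-subdiagonal : toℕ i ≡ suc (toℕ j) → cartanA n i j ≡ -1ℤ
  cartanA-subdiagonal i≡1+j with toℕ i ℕ.≟ toℕ j | suc (toℕ i) ℕ.≟ toℕ j | toℕ i ℕ.≟ suc (toℕ j)
  ... | yes i≡j | _        | _        = contradiction (trans (sym i≡1+j) i≡j) 1+n≢n
  ... | no _    | yes 1+i≡j | _       =
    contradiction (≤-reflexive (sym i≡1+j)) (<-asym (≤-reflexive 1+i≡j))
  ... | no _    | no _     | yes _    = refl
  ... | no _    | no _     | no i≢1+j = contradiction i≡1+j i≢1+j

  cartanA-aboveBand : suc (toℕ i) < toℕ j → cartanA n i j ≡ 0ℤ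
  cartanA-aboveBand 1+i<j with toℕ i ℕ.≟ toℕ j | suc (toℕ i) ℕ.≟ toℕ j | toℕ i ℕ.≟ suc (toℕ j)
  ... | yes i≡j | _        | _        = contradiction i≡j (<⇒≢ (<-trans (n<1+n _) 1+i<j))
  ... | no _    | yes 1+i≡j | _       = contradiction 1+i≡j (<⇒≢ 1+i<j)
  ... | no _    | no _     | yes i≡1+j =
    contradiction (≤-reflexive (sym i≡1+j)) (<-asym (<-trans (n<1+n _) 1+i<j))
  ... | no _    | no _     | no _     = refl

  cartanA-belowBand : suc (toℕ j) < toℕ i → cartanA n i j ≡ 0ℤ
  cartanA-belowBand 1+j<i with toℕ i ℕ.≟ toℕ j | suc (toℕ i) ℕ.≟ toℕ j | toℕ i ℕ.≟ suc (toℕ j)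
  ... | yes i≡j | _        | _        = contradiction i≡j (>⇒≢ (<-trans (n<1+n _) 1+j<i))
  ... | no _    | yes 1+i≡j | _       =
    contradiction (≤-reflexive 1+i≡j) (<-asym (<-trans (n<1+n _) 1+j<i))
  ... | no _    | no _     | yes i≡1+j = contradiction i≡1+j (>⇒≢ 1+j<i)
  ... | no _    | no _     | no _     = refl

module _ {k n : ℕ} {f : Fin (suc k) → Fin n} (f↑ : StrictlyIncreasing f) where

  StrictlyIncreasing-tail : StrictlyIncreasing (f ∘ suc)
  StrictlyIncreasing-tail i j i<j = f↑ (suc i) (suc j) (s≤s i<j)

  head<suc : ∀ i → toℕ (f zero) < toℕ (f (suc i))
  head<suc i = f↑ zero (suc i) (s≤s z≤n)

  head≤ : ∀ i → toℕ (f zero) ≤ toℕ (f i)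
  head≤ zero    = ≤-refl
  head≤ (suc i) = <⇒≤ (head<suc i)

record Selection (n k : ℕ) : Set where
  field
    rows cols : Fin k → Fin n
    rows↑     : StrictlyIncreasing rows
    cols↑     : StrictlyIncreasing cols

open Selection

module _ {n : ℕ} where

  matrix : ∀ {k} → Selection n k → Matrix k
  matrix S = submatrix (cartanA n) (rows S) (cols S)

  tail : ∀ {k} → Selection n (suc k) → Selection n k
  tail S = record
    { rows  = rows S ∘ suc
    ; cols  = cols S ∘ suc
    ; rows↑ = StrictlyIncreasing-tail (rows↑ S)
    ; cols↑ = StrictlyIncreasing-tail (cols↑ S)
    }

  r₀ c₀ : ∀ {k} → Selection n (suc k) → ℕ
  r₀ S = toℕ (rows S zero)
  c₀ S = toℕ (cols S zero)

  -- No diagonal block of S begins before start S.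
  start : ∀ {k} → Selection n k → ℕ
  start {zero}  S = suc n
  start {suc k} S = r₀ S ⊔ c₀ S

  start-tail : ∀ {k} (S : Selection n (suc k)) → start S ≤ start (tail S)
  start-tail {zero}  S =
    ⊔-lub (<⇒≤ (m<n⇒m<1+n (toℕ<n (rows S zero)))) (<⇒≤ (m<n⇒m<1+n (toℕ<n (cols S zero))))
  start-tail {suc k} S = ⊔-mono-≤ (<⇒≤ (head<suc (rows↑ S) zero)) (<⇒≤ (head<suc (cols↑ S) zero))

  r₁ c₁ : ∀ {k} → Selection n (suc (suc k)) → ℕ
  r₁ = r₀ ∘ tail
  c₁ = c₀ ∘ tail

  module _ {k} (S : Selection n (suc k)) where

    det-aboveBand : suc (r₀ S) < c₀ S → det (suc k) (matrix S) ≡ 0ℤ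
    det-aboveBand r₀≪c₀ = det-zeroRow₀ (matrix S) (λ j →
      cartanA-aboveBand (<-≤-trans r₀≪c₀ (head≤ (cols↑ S) j)))

    det-belowBand : suc (c₀ S) < r₀ S → det (suc k) (matrix S) ≡ 0ℤ
    det-belowBand c₀≪r₀ = det-zeroCol₀ (matrix S) (λ i →
      cartanA-belowBand (<-≤-trans c₀≪r₀ (head≤ (rows↑ S) i)))

    det-superdiagonal : suc (r₀ S) ≡ c₀ S → det (suc k) (matrix S) ≡ - det k (matrix (tail S))
    det-superdiagonal 1+r₀≡c₀ = begin
      det (suc k) (matrix S)
        ≡⟨ det-row₀-oneTerm (matrix S) (λ j →
             cartanA-aboveBand (≤-<-trans (≤-reflexive 1+r₀≡c₀) (head<suc (cols↑ S) j))) ⟩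
      matrix S zero zero * det k (matrix (tail S))
        ≡⟨ cong (_* det k (matrix (tail S))) (cartanA-superdiagonal 1+r₀≡c₀) ⟩
      -1ℤ * det k (matrix (tail S))
        ≡⟨ ℤ.-1*i≡-i _ ⟩
      - det k (matrix (tail S)) ∎
      where open ≡-Reasoning

    det-subdiagonal : r₀ S ≡ suc (c₀ S) → det (suc k) (matrix S) ≡ - det k (matrix (tail S))
    det-subdiagonal r₀≡1+c₀ = begin
      det (suc k) (matrix S)
        ≡⟨ det-col₀-oneTerm (matrix S) (λ i →
             cartanA-belowBand (≤-<-trans (≤-reflexive (sym r₀≡1+c₀)) (head<suc (rows↑ S) i))) ⟩
      matrix S zero zero * det k (matrix (tail S))
        ≡⟨ cong (_* det k (matrix (tail S))) (cartanA-subdiagonal r₀≡1+c₀) ⟩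
      -1ℤ * det k (matrix (tail S))
        ≡⟨ ℤ.-1*i≡-i _ ⟩
      - det k (matrix (tail S)) ∎
      where open ≡-Reasoning

  module _ {k} (S : Selection n (suc (suc k))) where

    coupling : ℤ
    coupling = matrix S (suc zero) zero * det (suc k) (minor (matrix S) (suc zero))

    det-diagonal : r₀ S ≡ c₀ S →
                   det (suc (suc k)) (matrix S) ≡ + 2 * det (suc k) (matrix (tail S)) - coupling
    det-diagonal r₀≡c₀ =
      trans (det-col₀-twoTerms (matrix S) (λ i → cartanA-belowBand (c₀≪rows i)))
            (cong (λ a → a * det (suc k) (matrix (tail S)) - coupling) (cartanA-diagonal r₀≡c₀))
      where
      c₀≪rows : ∀ i → suc (c₀ S) < toℕ (rows S (suc (suc i)))
      c₀≪rows i = subst (λ c → suc c < toℕ (rows S (suc (suc i)))) r₀≡c₀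
        (≤-<-trans (head<suc (rows↑ S) zero) (head<suc (rows↑ (tail S)) i))

    coupling-belowBand : suc (c₀ S) < r₁ S → coupling ≡ 0ℤ
    coupling-belowBand c₀≪r₁ =
      trans (cong (_* det (suc k) (minor (matrix S) (suc zero))) (cartanA-belowBand c₀≪r₁))
            (ℤ.*-zeroˡ (det (suc k) (minor (matrix S) (suc zero))))

    coupling-aboveBand : suc (r₀ S) < c₁ S → coupling ≡ 0ℤ
    coupling-aboveBand r₀≪c₁ =
      trans (cong (matrix S (suc zero) zero *_)
                  (det-zeroRow₀ (minor (matrix S) (suc zero)) (λ j →
                     cartanA-aboveBand (<-≤-trans r₀≪c₁ (head≤ (cols↑ (tail S)) j)))))
            (ℤ.*-zeroʳ (matrix S (suc zero) zero))

    coupling-run : r₁ S ≡ suc (c₀ S) → suc (r₀ S) ≡ c₁ S → coupling ≡ det k (matrix (tail (tail S)))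
    coupling-run r₁≡1+c₀ 1+r₀≡c₁ = begin
      matrix S (suc zero) zero * det (suc k) (minor (matrix S) (suc zero))
        ≡⟨ cong₂ _*_ (cartanA-subdiagonal r₁≡1+c₀)
                     (det-row₀-oneTerm (minor (matrix S) (suc zero)) (λ j →
                        cartanA-aboveBand (≤-<-trans (≤-reflexive 1+r₀≡c₁) (head<suc (cols↑ (tail S)) j)))) ⟩
      -1ℤ * (matrix S zero (suc zero) * d)
        ≡⟨ cong (λ a → -1ℤ * (a * d)) (cartanA-superdiagonal 1+r₀≡c₁) ⟩
      -1ℤ * (-1ℤ * d)
        ≡⟨ trans (ℤ.-1*i≡-i _) (cong -_ (ℤ.-1*i≡-i d)) ⟩
      - - d
        ≡⟨ ℤ.neg-involutive d ⟩
      d ∎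
      where
      open ≡-Reasoning
      d = det k (matrix (tail (tail S)))

cartanDet-recurrence : ∀ p e → + 2 * (+ suc (suc p) * e) - + suc p * e ≡ + suc (suc (suc p)) * e
cartanDet-recurrence p = polynomial (+ p)
  where
  -- + suc m is definitionally 1ℤ ℤ.+ + m, a form the ring solver can normalise.
  polynomial : ∀ P e → + 2 * ((1ℤ ℤ.+ (1ℤ ℤ.+ P)) * e) - (1ℤ ℤ.+ P) * e
                       ≡ (1ℤ ℤ.+ (1ℤ ℤ.+ (1ℤ ℤ.+ P))) * e
  polynomial = solve-∀

-- |d| is a product of determinants 1 + μᵢ of Cartan blocks A_μᵢ, where each block occupies
-- μᵢ consecutive indices followed by one index it leaves free, all within β, …, n.
record Blocks (n β : ℕ) (d : ℤ) : Set where
  field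
    sizes    : List ℕ
    positive : All (0 <_) sizes
    fit      : β + sum (map suc sizes) ≤ suc n
    abs-det  : ∣ d ∣ ≡ product (map suc sizes)

open Blocks

BlockDet : ℕ → ℕ → ℤ → Set
BlockDet n β d = d ≡ 0ℤ ⊎ Blocks n β d

module _ {n : ℕ} where

  BlockDet-one : ∀ {β} → β ≤ suc n → BlockDet n β 1ℤ
  BlockDet-one {β} β≤1+n = inj₂ record
    { sizes    = []
    ; positive = []
    ; fit      = subst (_≤ suc n) (sym (+-identityʳ β)) β≤1+n
    ; abs-det  = refl
    }

  BlockDet-weaken : ∀ {β β′ d} → β ≤ β′ → BlockDet n β′ d → BlockDet n β d
  BlockDet-weaken β≤β′ (inj₁ d≡0) = inj₁ d≡0
  BlockDet-weaken β≤β′ (inj₂ B)   = inj₂ record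
    { sizes    = sizes B
    ; positive = positive B
    ; fit      = ≤-trans (+-monoˡ-≤ (sum (map suc (sizes B))) β≤β′) (fit B)
    ; abs-det  = abs-det B
    }

  BlockDet-neg : ∀ {β d} → BlockDet n β d → BlockDet n β (- d)
  BlockDet-neg (inj₁ refl) = inj₁ refl
  BlockDet-neg {d = d} (inj₂ B) = inj₂ record
    { sizes    = sizes B
    ; positive = positive B
    ; fit      = fit B
    ; abs-det  = trans (ℤ.∣-i∣≡∣i∣ d) (abs-det B)
    }

  BlockDet-addBlock : ∀ {β p e} → BlockDet n (suc (suc p) + β) e → BlockDet n β (+ suc (suc p) * e)
  BlockDet-addBlock {p = p} (inj₁ refl) = inj₁ (ℤ.*-zeroʳ (+ suc (suc p)))
  BlockDet-addBlock {β} {p} {e} (inj₂ B) = inj₂ record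
    { sizes    = suc p ∷ sizes B
    ; positive = s≤s z≤n ∷ positive B
    ; fit      = subst (_≤ suc n)
                       (trans (cong (_+ sum (map suc (sizes B))) (+-comm (suc (suc p)) β))
                              (+-assoc β (suc (suc p)) _))
                       (fit B)
    ; abs-det  = trans (ℤ.abs-* (+ suc (suc p)) e) (cong (suc (suc p) ℕ.*_) (abs-det B))
    }

module _ {n : ℕ} where

  -- S begins with p + 1 common row and column indices c₀, …, c₀ + p, where it is the block
  -- A_{p+1}; the block splits off its determinant p + 2 and leaves the cofactor behind.
  record DiagonalRun {k} (S : Selection n (suc k)) : Set where
    field
      p               : ℕ
      cofactor        : ℤ
      det≡            : det (suc k) (matrix S) ≡ + suc (suc p) * cofactor
      det-tail≡       : det k (matrix (tail S)) ≡ + suc p * cofactor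
      cofactor-blocks : BlockDet n (suc (suc p) + c₀ S) cofactor

  module _ {k} (S : Selection n (suc k)) where

    blockDet-diagonal : r₀ S ≡ c₀ S → DiagonalRun S → BlockDet n (start S) (det (suc k) (matrix S))
    blockDet-diagonal r₀≡c₀ run =
      subst (BlockDet n (start S)) (sym det≡)
        (BlockDet-weaken start≤c₀ (BlockDet-addBlock cofactor-blocks))
      where
      open DiagonalRun run
      start≤c₀ : start S ≤ c₀ S
      start≤c₀ = ≤-reflexive (trans (cong (_⊔ c₀ S) r₀≡c₀) (⊔-idem (c₀ S)))

    blockDet-negTail : det (suc k) (matrix S) ≡ - det k (matrix (tail S)) →
                       BlockDet n (start (tail S)) (det k (matrix (tail S))) →
                       BlockDet n (start S) (det (suc k) (matrix S))
    blockDet-negTail det≡-tail tail-blocks =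
      subst (BlockDet n (start S)) (sym det≡-tail)
        (BlockDet-neg (BlockDet-weaken (start-tail S) tail-blocks))

  diagonalRun-single : (S : Selection n 1) → r₀ S ≡ c₀ S → DiagonalRun S
  diagonalRun-single S r₀≡c₀ = record
    { p               = 0
    ; cofactor        = 1ℤ
    ; det≡            = cong (λ a → 1ℤ * (a * 1ℤ) ℤ.+ 0ℤ) (cartanA-diagonal r₀≡c₀)
    ; det-tail≡       = refl
    ; cofactor-blocks = BlockDet-one (s≤s (toℕ<n (cols S zero)))
    }

  module _ {k} (S : Selection n (suc (suc k))) (r₀≡c₀ : r₀ S ≡ c₀ S) where

    diagonalRun-end : coupling S ≡ 0ℤ → suc (suc (c₀ S)) ≤ start (tail S) →
                      BlockDet n (start (tail S)) (det (suc k) (matrix (tail S))) → DiagonalRun S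
    diagonalRun-end coupling≡0 c₀≪start tail-blocks = record
      { p               = 0
      ; cofactor        = d
      ; det≡            = trans (det-diagonal S r₀≡c₀)
                                (trans (cong (λ b → + 2 * d - b) coupling≡0) (ℤ.+-identityʳ (+ 2 * d)))
      ; det-tail≡       = sym (ℤ.*-identityˡ d)
      ; cofactor-blocks = BlockDet-weaken c₀≪start tail-blocks
      }
      where d = det (suc k) (matrix (tail S))

    diagonalRun-extend : suc (c₀ S) ≡ r₁ S → suc (c₀ S) ≡ c₁ S → DiagonalRun (tail S) → DiagonalRun S
    diagonalRun-extend 1+c₀≡r₁ 1+c₀≡c₁ run = record
      { p               = suc p
      ; cofactor        = cofactor
      ; det≡            = begin
          det (suc (suc k)) (matrix S)
            ≡⟨ det-diagonal S r₀≡c₀ ⟩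
          + 2 * det (suc k) (matrix (tail S)) - coupling S
            ≡⟨ cong₂ (λ a b → + 2 * a - b) det≡
                     (trans (coupling-run S (sym 1+c₀≡r₁) (trans (cong suc r₀≡c₀) 1+c₀≡c₁)) det-tail≡) ⟩
          + 2 * (+ suc (suc p) * cofactor) - + suc p * cofactor
            ≡⟨ cartanDet-recurrence p cofactor ⟩
          + suc (suc (suc p)) * cofactor ∎
      ; det-tail≡       = det≡
      ; cofactor-blocks = subst (λ β → BlockDet n β cofactor)
                                (trans (cong (λ c → suc (suc p) + c) (sym 1+c₀≡c₁))
                                       (+-suc (suc (suc p)) (c₀ S)))
                                cofactor-blocks
      }
      where
      open ≡-Reasoning
      open DiagonalRun run

    diagonalRun-step : (r₁ S ≡ c₁ S → DiagonalRun (tail S)) →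
                       BlockDet n (start (tail S)) (det (suc k) (matrix (tail S))) → DiagonalRun S
    diagonalRun-step tail-run tail-blocks
      with m≤n⇒m<n∨m≡n (subst (_< r₁ S) r₀≡c₀ (head<suc (rows↑ S) zero))
         | m≤n⇒m<n∨m≡n (head<suc (cols↑ S) zero)
    ... | inj₂ 1+c₀≡r₁ | inj₂ 1+c₀≡c₁ =
      diagonalRun-extend 1+c₀≡r₁ 1+c₀≡c₁ (tail-run (trans (sym 1+c₀≡r₁) 1+c₀≡c₁))
    ... | inj₂ _ | inj₁ c₀≪c₁ =
      diagonalRun-end (coupling-aboveBand S (subst (λ r → suc r < c₁ S) (sym r₀≡c₀) c₀≪c₁))
                      (m≤n⇒m≤o⊔n (r₁ S) c₀≪c₁) tail-blocks
    ... | inj₁ c₀≪r₁ | _ =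
      diagonalRun-end (coupling-belowBand S c₀≪r₁) (m≤n⇒m≤n⊔o (c₁ S) c₀≪r₁) tail-blocks

  blockDet-step : ∀ {k} (S : Selection n (suc k)) → (r₀ S ≡ c₀ S → DiagonalRun S) →
                  BlockDet n (start (tail S)) (det k (matrix (tail S))) →
                  BlockDet n (start S) (det (suc k) (matrix S))
  blockDet-step S run tail-blocks with bandPosition (r₀ S) (c₀ S)
  ... | diagonal r₀≡c₀        = blockDet-diagonal S r₀≡c₀ (run r₀≡c₀)
  ... | superdiagonal 1+r₀≡c₀ = blockDet-negTail S (det-superdiagonal S 1+r₀≡c₀) tail-blocks
  ... | subdiagonal r₀≡1+c₀   = blockDet-negTail S (det-subdiagonal S r₀≡1+c₀) tail-blocks
  ... | aboveBand r₀≪c₀       = inj₁ (det-aboveBand S r₀≪c₀)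
  ... | belowBand c₀≪r₀       = inj₁ (det-belowBand S c₀≪r₀)

  blockDet    : ∀ {k} (S : Selection n k) → BlockDet n (start S) (det k (matrix S))
  diagonalRun : ∀ {k} (S : Selection n (suc k)) → r₀ S ≡ c₀ S → DiagonalRun S

  blockDet {zero}  S = BlockDet-one ≤-refl
  blockDet {suc k} S = blockDet-step S (diagonalRun S) (blockDet (tail S))

  diagonalRun {zero}  S = diagonalRun-single S
  diagonalRun {suc k} S r₀≡c₀ = diagonalRun-step S r₀≡c₀ (diagonalRun (tail S)) (blockDet (tail S))

sum-map-suc : ∀ xs → sum (map suc xs) ≡ sum xs + length xs
sum-map-suc []       = refl
sum-map-suc (x ∷ xs) = begin
  suc x + sum (map suc xs)       ≡⟨ cong (λ s → suc x + s) (sum-map-suc xs) ⟩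
  suc (x + (sum xs + length xs)) ≡⟨ cong suc (+-assoc x (sum xs) (length xs)) ⟨
  suc (x + sum xs + length xs)   ≡⟨ +-suc (x + sum xs) (length xs) ⟨
  x + sum xs + suc (length xs)   ∎
  where open ≡-Reasoning

sum-map-suc≤1+n⇒sum≤n : ∀ {n} xs → sum (map suc xs) ≤ suc n → sum xs ≤ n
sum-map-suc≤1+n⇒sum≤n []       _           = z≤n
sum-map-suc≤1+n⇒sum≤n (x ∷ xs) (s≤s bound) =
  ≤-trans (+-monoʳ-≤ x (≤-trans (m≤m+n (sum xs) (length xs)) (≤-reflexive (sym (sum-map-suc xs)))))
          bound

m!*n!∣[m+n]! : ∀ m n → m ! ℕ.* n ! ∣ (m + n) !
m!*n!∣[m+n]! m n = subst (λ o → m ! ℕ.* o ! ∣ (m + n) !) (m+n∸m≡n m n) (k![n∸k]!∣n! (m≤m+n m n))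

product-map-suc∣sum-map-suc! : ∀ xs → product (map suc xs) ∣ sum (map suc xs) !
product-map-suc∣sum-map-suc! []       = ∣-refl
product-map-suc∣sum-map-suc! (x ∷ xs) =
  ∣-trans (*-pres-∣ (m∣m*n {suc x} (x !)) (product-map-suc∣sum-map-suc! xs))
          (m!*n!∣[m+n]! (suc x) (sum (map suc xs)))

All⇒AllPositive : ∀ {xs} → All (0 <_) xs → AllPositive xs
All⇒AllPositive []       = []
All⇒AllPositive (p ∷ ps) = p ∷ All⇒AllPositive ps

Linked≥⇒Decreasing : ∀ {xs} → Linked (λ x y → y ≤ x) xs → Decreasing xs
Linked≥⇒Decreasing []              = []
Linked≥⇒Decreasing ([-] {x})       = [ x ]
Linked≥⇒Decreasing (y≤x ∷ ordered) = y≤x ∷ Linked≥⇒Decreasing ordered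

module _ {n β : ℕ} {d : ℤ} (B : Blocks n β d) where

  weight≤1+n : sum (map suc (sizes B)) ≤ suc n
  weight≤1+n = m+n≤o⇒n≤o β (fit B)

  Blocks⇒∣[n+1]! : ∣ d ∣ ∣ (n + 1) !
  Blocks⇒∣[n+1]! = subst (λ m → ∣ d ∣ ∣ m !) (+-comm 1 n)
    (subst (_∣ suc n !) (sym (abs-det B))
      (∣-trans (product-map-suc∣sum-map-suc! (sizes B)) (m≤n⇒m!∣n! weight≤1+n)))

  Blocks⇒partition : ∃[ m ] ∃[ μ ] (m ≤ n × IsPartition m μ × length μ ≤ n + 1 ∸ m
                                     × ∣ d ∣ ≡ product (map suc μ))
  Blocks⇒partition = sum μ , μ , sum-map-suc≤1+n⇒sum≤n μ μ-weight , isPartition , length≤ , abs≡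
    where
    μ = sort (sizes B)
    μ↭ : map suc μ ↭ map suc (sizes B)
    μ↭ = map⁺ suc (sort-↭ (sizes B))
    μ-weight : sum (map suc μ) ≤ suc n
    μ-weight = subst (_≤ suc n) (sym (sum-↭ μ↭)) weight≤1+n
    isPartition : IsPartition (sum μ) μ
    isPartition = record
      { positive   = All⇒AllPositive (All-resp-↭ (↭-sym (sort-↭ (sizes B))) (positive B))
      ; decreasing = Linked≥⇒Decreasing (sort-↗ (sizes B))
      ; sums       = refl
      }
    length≤ : length μ ≤ n + 1 ∸ sum μ
    length≤ = m+n≤o⇒m≤o∸n (length μ)
      (subst₂ _≤_ (trans (sum-map-suc μ) (+-comm (sum μ) (length μ))) (+-comm 1 n) μ-weight)
    abs≡ : ∣ d ∣ ≡ product (map suc μ)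
    abs≡ = trans (abs-det B) (sym (product-↭ μ↭))

proposition5p4 : (n k : ℕ) (rs cs : Fin k → Fin n) →
    StrictlyIncreasing rs → StrictlyIncreasing cs →
    (det k (submatrix (cartanA n) rs cs) ≡ 0ℤ
      ⊎ ∃[ m ] ∃[ μ ] (m ≤ n × IsPartition m μ × length μ ≤ n + 1 ∸ m
          × ∣ det k (submatrix (cartanA n) rs cs) ∣ ≡ product (map suc μ)))
    × (det k (submatrix (cartanA n) rs cs) ≢ 0ℤ →
        ∣ det k (submatrix (cartanA n) rs cs) ∣ ∣ (n + 1) !)
proposition5p4 n k rs cs rs↑ cs↑
  with blockDet (record { rows = rs ; cols = cs ; rows↑ = rs↑ ; cols↑ = cs↑ })
... | inj₁ det≡0 = inj₁ det≡0 , λ det≢0 → contradiction det≡0 det≢0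
... | inj₂ B     = inj₂ (Blocks⇒partition B) , λ _ → Blocks⇒∣[n+1]! B
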